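{- Let $\mathcal{H}=(V,H)$ be a boolean representable connected simplicial complex. Let $u,v\in V$ belong to distinct connected components of $\Gamma\mathrm{Fl}\mathcal{H}$. Then $\{u,v\}\in H$.
   Context: A (finite) simplicial complex is a pair $\mathcal{H}=(V,H)$ with $V$ finite nonempty and $H\subseteq 2^V$ containing all singletons and closed under subsets; it is connected if the graph with vertex set $V$ and edges the 2-element faces is connected. A boolean matrix with row set $R$ and column set $V$ is nonsingular if, after independently permuting rows and columns, it is square lower unitriangular; $X\subseteq V$ is $M$-independent if some submatrix $M[Y,X]$ is nonsingular; $\mathcal{H}$ is boolean representable if $H$ is the set of $M$-independent subsets for some boolean matrix $M$. A flat is a set $X\subseteq V$ with $I\cup\{p\}\in H$ for all $I\in H$, $I\subseteq X$, $p\in V\setminus X$; $\overline{X}$ is the intersection of flats containing $X$. The graph of flats $\Gamma\mathrm{Fl}\mathcal{H}$ has vertex set $V$ and edges $p - q$ for $p\neq q$ with $\overline{\{p,q\}}\neq V$. -}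

module Defs where

open import Data.Nat using (ℕ; zero; suc; _<_)
open import Data.Bool using (Bool; true; false)
open import Data.Fin using (Fin; toℕ)
open import Data.Fin.Subset using (Subset; _∈_; _∉_; _⊆_; ⁅_⁆; _∪_)
open import Data.Product using (Σ; _×_; ∃; _,_)
open import Relation.Binary.PropositionalEquality using (_≡_; _≢_)
open import Relation.Nullary using (¬_)
open import Function.Definitions using (Injective)
open import Relation.Binary.Construct.Closure.ReflexiveTransitive using (Star)

-- Vertex set V = Fin n (nonempty: n = suc k). A family of faces H is given
-- by its (boolean) characteristic function on subsets of V.
Family : ℕ → Set
Family n = Subset n → Bool

_∈H_ : ∀ {n} → Subset n → Family n → Set
X ∈H H = H X ≡ true

record IsSimplicialComplex {n : ℕ} (H : Family n) : Set where
  field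
    singletons : ∀ (p : Fin n) → ⁅ p ⁆ ∈H H
    downClosed : ∀ (X Y : Subset n) → X ⊆ Y → Y ∈H H → X ∈H H

HEdge : ∀ {n} → Family n → Fin n → Fin n → Set
HEdge H p q = p ≢ q × ((⁅ p ⁆ ∪ ⁅ q ⁆) ∈H H)

Connected : ∀ {n} → Family n → Set
Connected H = ∀ p q → Star (HEdge H) p q

BoolMatrix : ℕ → ℕ → Set
BoolMatrix m n = Fin m → Fin n → Bool

-- X is M-independent: there is a k×k submatrix M[Y,X] which, with rows
-- ordered by the injection f : Fin k → Fin m (enumerating Y) and columns
-- ordered by the injection g : Fin k → Fin n (enumerating X), is lower
-- unitriangular: ones on the diagonal, zeros strictly above it.
Independent : ∀ {m n} → BoolMatrix m n → Subset n → Set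
Independent {m} {n} M X =
  Σ ℕ λ k → Σ (Fin k → Fin m) λ f → Σ (Fin k → Fin n) λ g →
    Injective _≡_ _≡_ f × Injective _≡_ _≡_ g ×
    (∀ (x : Fin n) → (x ∈ X → Σ (Fin k) λ i → g i ≡ x) × (∀ (i : Fin k) → g i ≡ x → x ∈ X)) ×
    (∀ (i : Fin k) → M (f i) (g i) ≡ true) ×
    (∀ (i j : Fin k) → toℕ i < toℕ j → M (f i) (g j) ≡ false)

BooleanRepresentable : ∀ {n} → Family n → Set
BooleanRepresentable {n} H =
  Σ ℕ λ m → Σ (BoolMatrix m n) λ M →
    ∀ (X : Subset n) → (X ∈H H → Independent M X) × (Independent M X → X ∈H H)

IsFlat : ∀ {n} → Family n → Subset n → Set
IsFlat {n} H X =
  ∀ (I : Subset n) → I ∈H H → I ⊆ X → ∀ (p : Fin n) → p ∉ X → (I ∪ ⁅ p ⁆) ∈H H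

InClosure : ∀ {n} → Family n → Subset n → Fin n → Set
InClosure {n} H X r = ∀ (F : Subset n) → IsFlat H F → X ⊆ F → r ∈ F

FlEdge : ∀ {n} → Family n → Fin n → Fin n → Set
FlEdge H p q = p ≢ q × ¬ (∀ r → InClosure H (⁅ p ⁆ ∪ ⁅ q ⁆) r)

SameFlComponent : ∀ {n} → Family n → Fin n → Fin n → Set
SameFlComponent H = Star (FlEdge H)

-- Let M represent H. If the columns of u and v differ, the 2×2
-- submatrix on columns u, v and two suitable rows is (after ordering) lower
-- unitriangular, so {u, v} is a face. If the columns coincide, the class P of
-- all columns equal to that of u is a flat: an independent subset of P has at
-- most one element (equal columns cannot both occur in a unitriangular
-- submatrix), and adding a column outside P keeps it independent. Since H is
-- connected, u has a neighbour w, which lies outside P, so the closure of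
-- {u, v} is contained in P ≠ V and u — v is an edge of ΓFl H.
module Submission where

open import Defs
open import Data.Nat using (ℕ; suc; s≤s; _<_)
open import Data.Nat.Properties using (<-cmp)
open import Data.Bool using (true; false)
import Data.Bool.Properties as Bool
open import Data.Fin using (Fin; zero; suc; toℕ)
open import Data.Fin.Properties using (all?; ¬∀⟶∃¬; toℕ-injective)
open import Data.Fin.Subset using (Subset; _∈_; _∉_; _⊆_; ⁅_⁆; _∪_; ⊥)
open import Data.Fin.Subset.Properties
  using (x∈⁅x⁆; x∈⁅y⁆⇒x≡y; x∈p∪q⁻; x∈p∪q⁺; nonempty?; Empty-unique; ⊆-antisym; ∪-comm; ∪-identityˡ)
open import Data.Vec using (tabulate)
open import Data.Vec.Properties using (lookup∘tabulate; []=⇒lookup; lookup⇒[]=)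
open import Data.Product using (Σ; ∃; _×_; _,_; proj₁; proj₂)
open import Data.Sum using (_⊎_; inj₁; inj₂)
open import Data.Empty using (⊥-elim)
open import Function using (_∘_)
open import Function.Definitions using (Injective)
open import Relation.Binary using (Rel; tri<; tri≈; tri>)
open import Relation.Binary.Construct.Closure.ReflexiveTransitive using (Star; ε; _◅_)
open import Relation.Binary.PropositionalEquality using (_≡_; _≢_; refl; sym; trans; subst)
open import Relation.Nullary using (¬_; Dec; yes; no; does; contradiction)
open import Relation.Nullary.Decidable using (dec-true)
open import Relation.Unary using (Pred; Decidable)

Star⇒∃-step : ∀ {a r} {A : Set a} {R : Rel A r} {u v : A} → Star R u v → u ≢ v → ∃ (R u)
Star⇒∃-step ε         u≢u = contradiction refl u≢u
Star⇒∃-step (uRw ◅ _) _   = _ , uRw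

module _ {n : ℕ} where

  subsetOf : ∀ {ℓ} {P : Pred (Fin n) ℓ} → Decidable P → Subset n
  subsetOf P? = tabulate (does ∘ P?)

  ∈-subsetOf⁺ : ∀ {ℓ} {P : Pred (Fin n) ℓ} (P? : Decidable P) {x} → P x → x ∈ subsetOf P?
  ∈-subsetOf⁺ P? {x} px = lookup⇒[]= x _ (trans (lookup∘tabulate _ x) (dec-true (P? x) px))

  ∈-subsetOf⁻ : ∀ {ℓ} {P : Pred (Fin n) ℓ} (P? : Decidable P) {x} → x ∈ subsetOf P? → P x
  ∈-subsetOf⁻ P? {x} x∈ with P? x | trans (sym (lookup∘tabulate _ x)) ([]=⇒lookup x∈)
  ... | yes px | _ = px
  ... | no _   | ()

  ⁅⁆∪⁅⁆⊆ : ∀ {a b : Fin n} {X : Subset n} → a ∈ X → b ∈ X → ⁅ a ⁆ ∪ ⁅ b ⁆ ⊆ X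
  ⁅⁆∪⁅⁆⊆ {a} {b} a∈X b∈X x∈ with x∈p∪q⁻ ⁅ a ⁆ ⁅ b ⁆ x∈
  ... | inj₁ x∈⁅a⁆ = subst (_∈ _) (sym (x∈⁅y⁆⇒x≡y a x∈⁅a⁆)) a∈X
  ... | inj₂ x∈⁅b⁆ = subst (_∈ _) (sym (x∈⁅y⁆⇒x≡y b x∈⁅b⁆)) b∈X

pair : ∀ {A : Set} → A → A → Fin 2 → A
pair x y zero    = x
pair x y (suc _) = y

pair-injective : ∀ {A : Set} {x y : A} → x ≢ y → Injective _≡_ _≡_ (pair x y)
pair-injective x≢y {zero}     {zero}     _ = refl
pair-injective x≢y {zero}     {suc zero} e = contradiction e x≢y
pair-injective x≢y {suc zero} {zero}     e = contradiction (sym e) x≢y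
pair-injective x≢y {suc zero} {suc zero} _ = refl

module _ {m n : ℕ} (M : BoolMatrix m n) where

  SameColumn : Fin n → Fin n → Set
  SameColumn a b = ∀ r → M r a ≡ M r b

  sameColumn? : ∀ a b → Dec (SameColumn a b)
  sameColumn? a b = all? λ r → M r a Bool.≟ M r b

  NonzeroColumn : Fin n → Set
  NonzeroColumn p = ∃ λ s → M s p ≡ true

  -- Rows r, s and columns a, b, in this order, form the matrix [[1,0],[*,1]].
  Independent-pair : ∀ {r s a b} → M r a ≡ true → M r b ≡ false → M s b ≡ true →
                     Independent M (⁅ a ⁆ ∪ ⁅ b ⁆)
  Independent-pair {r} {s} {a} {b} ra rb sb =
    2 , pair r s , pair a b , pair-injective r≢s , pair-injective a≢b , members , diagonal , above
    where
    r≢s : r ≢ s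
    r≢s refl = contradiction (trans (sym rb) sb) λ ()
    a≢b : a ≢ b
    a≢b refl = contradiction (trans (sym ra) rb) λ ()
    members : ∀ x → (x ∈ ⁅ a ⁆ ∪ ⁅ b ⁆ → Σ (Fin 2) λ i → pair a b i ≡ x)
                  × (∀ i → pair a b i ≡ x → x ∈ ⁅ a ⁆ ∪ ⁅ b ⁆)
    members x = index , λ { zero refl → x∈p∪q⁺ (inj₁ (x∈⁅x⁆ a)) ; (suc zero) refl → x∈p∪q⁺ (inj₂ (x∈⁅x⁆ b)) }
      where
      index : x ∈ ⁅ a ⁆ ∪ ⁅ b ⁆ → Σ (Fin 2) λ i → pair a b i ≡ x
      index x∈ with x∈p∪q⁻ ⁅ a ⁆ ⁅ b ⁆ x∈
      ... | inj₁ x∈⁅a⁆ = zero , sym (x∈⁅y⁆⇒x≡y a x∈⁅a⁆)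
      ... | inj₂ x∈⁅b⁆ = suc zero , sym (x∈⁅y⁆⇒x≡y b x∈⁅b⁆)
    diagonal : ∀ i → M (pair r s i) (pair a b i) ≡ true
    diagonal zero       = ra
    diagonal (suc zero) = sb
    above : ∀ i j → toℕ i < toℕ j → M (pair r s i) (pair a b j) ≡ false
    above zero       (suc zero) _           = rb
    above (suc zero) (suc zero) (s≤s ())

  Independent-distinct-columns : ∀ {a b} → ¬ SameColumn a b → NonzeroColumn a → NonzeroColumn b →
                                 Independent M (⁅ a ⁆ ∪ ⁅ b ⁆)
  Independent-distinct-columns {a} {b} a≁b (sa , sa-a) (sb , sb-b)
    with ¬∀⟶∃¬ m _ (λ r → M r a Bool.≟ M r b) a≁b
  ... | r , ra≢rb with M r a in ra | M r b in rb
  ... | true  | true  = contradiction refl ra≢rb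
  ... | false | false = contradiction refl ra≢rb
  ... | true  | false = Independent-pair ra rb sb-b
  ... | false | true  = subst (Independent M) (∪-comm ⁅ b ⁆ ⁅ a ⁆) (Independent-pair rb ra sa-a)

  Independent⇒NonzeroColumn : ∀ {p} → Independent M ⁅ p ⁆ → NonzeroColumn p
  Independent⇒NonzeroColumn {p} (_ , f , g , _ , _ , members , diagonal , _)
    with proj₁ (members p) (x∈⁅x⁆ p)
  ... | i , refl = f i , diagonal i

  -- Equal columns at distinct positions i < j would put M (f i) (g i) = 1
  -- strictly above the diagonal, where M (f i) (g j) = 0.
  Independent⇒columns-distinct : ∀ {X a b} → Independent M X → a ∈ X → b ∈ X →
                                 SameColumn a b → a ≡ b
  Independent⇒columns-distinct (_ , f , g , _ , _ , members , diagonal , above) a∈X b∈X a∼b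
    with proj₁ (members _) a∈X | proj₁ (members _) b∈X
  ... | i , refl | j , refl with <-cmp (toℕ i) (toℕ j)
  ... | tri< i<j _ _ = contradiction (trans (sym (diagonal i)) (trans (a∼b (f i)) (above i j i<j))) λ ()
  ... | tri≈ _ i≡j _ = subst (λ k → g i ≡ g k) (toℕ-injective i≡j) refl
  ... | tri> _ _ j<i = contradiction (trans (sym (diagonal j)) (trans (sym (a∼b (f j))) (above j i j<i))) λ ()

  Independent-sameColumn⇒subsingleton : ∀ {I} → Independent M I →
    (∀ {a b} → a ∈ I → b ∈ I → SameColumn a b) → I ≡ ⊥ ⊎ ∃ λ q → I ≡ ⁅ q ⁆
  Independent-sameColumn⇒subsingleton {I} indep I-sameColumn with nonempty? I
  ... | no  empty     = inj₁ (Empty-unique empty)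
  ... | yes (q , q∈I) = inj₂ (q , ⊆-antisym I⊆⁅q⁆ ⁅q⁆⊆I)
    where
    I⊆⁅q⁆ : I ⊆ ⁅ q ⁆
    I⊆⁅q⁆ x∈I = subst (_∈ ⁅ q ⁆)
      (sym (Independent⇒columns-distinct indep x∈I q∈I (I-sameColumn x∈I q∈I))) (x∈⁅x⁆ q)
    ⁅q⁆⊆I : ⁅ q ⁆ ⊆ I
    ⁅q⁆⊆I x∈⁅q⁆ = subst (_∈ I) (sym (x∈⁅y⁆⇒x≡y q x∈⁅q⁆)) q∈I

flat-avoiding⇒FlEdge : ∀ {n} {H : Family n} {F : Subset n} {p q w} → IsFlat H F →
                       ⁅ p ⁆ ∪ ⁅ q ⁆ ⊆ F → w ∉ F → p ≢ q → FlEdge H p q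
flat-avoiding⇒FlEdge flat pq⊆F w∉F p≢q = p≢q , λ closure⊆ → w∉F (closure⊆ _ _ flat pq⊆F)

module Represented {m n : ℕ} {H : Family n} (complex : IsSimplicialComplex H)
                   (M : BoolMatrix m n)
                   (represents : ∀ X → (X ∈H H → Independent M X) × (Independent M X → X ∈H H))
                   where

  open IsSimplicialComplex complex

  face⇒Independent : ∀ {X} → X ∈H H → Independent M X
  face⇒Independent = proj₁ (represents _)

  Independent⇒face : ∀ {X} → Independent M X → X ∈H H
  Independent⇒face = proj₂ (represents _)

  nonzeroColumn : ∀ p → NonzeroColumn M p
  nonzeroColumn p = Independent⇒NonzeroColumn M (face⇒Independent (singletons p))

  columnClass : Fin n → Subset n
  columnClass u = subsetOf (λ p → sameColumn? M p u)

  ∈columnClass⁺ : ∀ {p u} → SameColumn M p u → p ∈ columnClass u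
  ∈columnClass⁺ {u = u} = ∈-subsetOf⁺ (λ p → sameColumn? M p u)

  ∈columnClass⁻ : ∀ {p u} → p ∈ columnClass u → SameColumn M p u
  ∈columnClass⁻ {u = u} = ∈-subsetOf⁻ (λ p → sameColumn? M p u)

  columnClass-isFlat : ∀ u → IsFlat H (columnClass u)
  columnClass-isFlat u I I∈H I⊆class p p∉class
    with Independent-sameColumn⇒subsingleton M (face⇒Independent I∈H) I-sameColumn
    where
    I-sameColumn : ∀ {a b} → a ∈ I → b ∈ I → SameColumn M a b
    I-sameColumn a∈I b∈I r =
      trans (∈columnClass⁻ (I⊆class a∈I) r) (sym (∈columnClass⁻ (I⊆class b∈I) r))
  ... | inj₁ refl       = subst (_∈H H) (sym (∪-identityˡ ⁅ p ⁆)) (singletons p)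
  ... | inj₂ (q , refl) =
    Independent⇒face (Independent-distinct-columns M q≁p (nonzeroColumn q) (nonzeroColumn p))
    where
    q≁p : ¬ SameColumn M q p
    q≁p q∼p = p∉class (∈columnClass⁺ λ r →
      trans (sym (q∼p r)) (∈columnClass⁻ (I⊆class (x∈⁅x⁆ q)) r))

  neighbour∉columnClass : ∀ {u w} → HEdge H u w → w ∉ columnClass u
  neighbour∉columnClass {u} (u≢w , uw∈H) w∈class =
    u≢w (Independent⇒columns-distinct M (face⇒Independent uw∈H)
           (x∈p∪q⁺ (inj₁ (x∈⁅x⁆ u))) (x∈p∪q⁺ (inj₂ (x∈⁅x⁆ _)))
           (λ r → sym (∈columnClass⁻ w∈class r)))

  sameColumn⇒FlEdge : Connected H → ∀ {u v} → u ≢ v → SameColumn M u v → FlEdge H u v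
  sameColumn⇒FlEdge connected {u} {v} u≢v u∼v with Star⇒∃-step (connected u v) u≢v
  ... | _ , uw = flat-avoiding⇒FlEdge (columnClass-isFlat u)
                   (⁅⁆∪⁅⁆⊆ (∈columnClass⁺ λ _ → refl) (∈columnClass⁺ (sym ∘ u∼v)))
                   (neighbour∉columnClass uw) u≢v

lemma3p2 : ∀ (k : ℕ) (H : Family (suc k)) → IsSimplicialComplex H →
    BooleanRepresentable H → Connected H →
    ∀ (u v : Fin (suc k)) → ¬ SameFlComponent H u v →
    (⁅ u ⁆ ∪ ⁅ v ⁆) ∈H H
lemma3p2 k H complex (m , M , represents) connected u v separated with sameColumn? M u v
... | no  u≁v = Independent⇒face (Independent-distinct-columns M u≁v (nonzeroColumn u) (nonzeroColumn v))
  where open Represented complex M represents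
... | yes u∼v = ⊥-elim (separated (sameColumn⇒FlEdge connected u≢v u∼v ◅ ε))
  where
  open Represented complex M represents
  u≢v : u ≢ v
  u≢v refl = separated ε
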